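{- Let $n\ge k\ge 3$ be integers and let $\mathcal{F}$ be a family of subsets of $[n]$ containing neither a copy of $Y_k$ nor a copy of $Y'_k$ on consecutive levels. Let $\sigma$ be a cyclic permutation of $[n]$, and for $0\le i\le n$ let $x_i$ be the number of intervals of size $i$ along $\sigma$ that belong to $\mathcal{F}$. Then for every $0 \le i \le n-k+1$, \[ x_i + x_{i+1} + \cdots + x_{i+k-1} \le (k-1)n. \]
   Context: A family $\mathcal{F}$ of subsets of $[n]$ contains a copy of $Y_k$ on consecutive levels if it contains $k+1$ distinct sets $F_1, F_2, G_1, \ldots, G_{k-1}$ with $G_1\subset \cdots \subset G_{k-1} \subset F_1$, $G_{k-1}\subset F_2$, and $|F_1| = |F_2| = |G_{k-1}|+1 = \cdots = |G_1|+k-1$; it contains a copy of $Y'_k$ on consecutive levels if it contains $k+1$ distinct sets with $G_1\supset\cdots\supset G_{k-1}\supset F_1$, $G_{k-1}\supset F_2$, and $|F_1|=|F_2|=|G_{k-1}|-1=\cdots=|G_1|-(k-1)$. A cyclic permutation $\sigma$ of $[n]$ is a cyclic ordering $a_1,\ldots,a_n,a_1$ of $[n]$; an interval along $\sigma$ is a set $\{a_{t+1},\ldots,a_{t+s}\}$ (indices modulo $n$), $0\le s\le n$; in particular $\emptyset$ and $[n]$ are the unique intervals of sizes $0$ and $n$, and there are $n$ intervals of each size $1\le s\le n-1$. -}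

module Defs where

open import Data.Bool using (Bool; true; false; _∧_; T)
import Data.Bool as B
open import Data.Nat using (ℕ; zero; suc; _+_; _∸_)
open import Data.Nat.DivMod using (_mod_)
open import Data.Fin using (Fin; toℕ)
open import Data.Fin.Subset using (Subset; ⊥; ⁅_⁆; _∪_; _⊂_; ∣_∣)
open import Data.Fin.Permutation using (Permutation′; _⟨$⟩ʳ_)
open import Data.List using (List; []; _∷_; _++_; map; foldr; upTo; filterᵇ; length; allFin)
open import Data.Bool.ListAction using (any)
open import Data.Vec using (Vec; []; _∷_)
open import Data.Vec.Properties using (≡-dec)
open import Data.Product using (Σ; _×_; ∃)
open import Relation.Binary.PropositionalEquality using (_≡_; _≢_)
open import Relation.Nullary.Decidable using (⌊_⌋)

Family : ℕ → Set
Family n = Subset n → Bool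

allSubsets : (n : ℕ) → List (Subset n)
allSubsets zero = [] ∷ []
allSubsets (suc n) = map (true ∷_) (allSubsets n) ++ map (false ∷_) (allSubsets n)

-- A cyclic permutation a_1,...,a_n is given by a permutation σ of Fin n,
-- a_{p+1} = σ p (positions 0-based).  The interval of size s starting after
-- position t is {a_{t+1},...,a_{t+s}} = { σ ((t + r) mod n) : r < s }.
interval : ∀ {n} → Permutation′ n → Fin n → ℕ → Subset n
interval {suc m} σ t s =
  foldr _∪_ ⊥ (map (λ r → ⁅ σ ⟨$⟩ʳ ((toℕ t + r) mod (suc m)) ⁆) (upTo s))

isIntervalᵇ : ∀ {n} → Permutation′ n → ℕ → Subset n → Bool
isIntervalᵇ {n} σ s S = any (λ t → ⌊ ≡-dec B._≟_ (interval σ t s) S ⌋) (allFin n)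

-- x_i : number of (distinct) intervals of size i along σ that belong to F
x : ∀ {n} → Permutation′ n → Family n → ℕ → ℕ
x {n} σ F i = length (filterᵇ (λ S → F S ∧ isIntervalᵇ σ i S) (allSubsets n))

-- Copy of Y_k on consecutive levels.  G j (j : Fin (k ∸ 1), 0-based) is G_{j+1}.
ContainsY : ∀ {n} → ℕ → Family n → Set
ContainsY {n} k F =
  Σ (Subset n) λ F₁ → Σ (Subset n) λ F₂ → Σ (Fin (k ∸ 1) → Subset n) λ G →
    (T (F F₁) × T (F F₂) × (∀ j → T (F (G j)))) ×
    (F₁ ≢ F₂ × (∀ i j → G i ≡ G j → i ≡ j) × (∀ j → G j ≢ F₁) × (∀ j → G j ≢ F₂)) ×
    (∀ i j → suc (toℕ i) ≡ toℕ j → G i ⊂ G j) ×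
    (∀ j → suc (toℕ j) ≡ k ∸ 1 → (G j ⊂ F₁ × G j ⊂ F₂)) ×
    (∣ F₁ ∣ ≡ ∣ F₂ ∣ × (∀ j → ∣ G j ∣ + (k ∸ 1 ∸ toℕ j) ≡ ∣ F₁ ∣))

ContainsY′ : ∀ {n} → ℕ → Family n → Set
ContainsY′ {n} k F =
  Σ (Subset n) λ F₁ → Σ (Subset n) λ F₂ → Σ (Fin (k ∸ 1) → Subset n) λ G →
    (T (F F₁) × T (F F₂) × (∀ j → T (F (G j)))) ×
    (F₁ ≢ F₂ × (∀ i j → G i ≡ G j → i ≡ j) × (∀ j → G j ≢ F₁) × (∀ j → G j ≢ F₂)) ×
    (∀ i j → suc (toℕ i) ≡ toℕ j → G j ⊂ G i) ×
    (∀ j → suc (toℕ j) ≡ k ∸ 1 → (F₁ ⊂ G j × F₂ ⊂ G j)) ×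
    (∣ F₁ ∣ ≡ ∣ F₂ ∣ × (∀ j → ∣ F₁ ∣ + (k ∸ 1 ∸ toℕ j) ≡ ∣ G j ∣))

-- Write σ as the N-periodic sequence a u = σ (u mod N) and let arc v s = {a v, …, a (v + s - 1)},
-- so that x s is at most the number of v < N with arc v s ∈ F.  For each v consider the window
-- formed by the ladder arc (v+1) (i+1) ⊂ … ⊂ arc (v+1) (i+k-2), the two arcs arc v (i+k-1) and
-- arc (v+1) (i+k-1) above its top, and the two arcs arc (v+1) i and arc (v+2) i below its bottom.
-- If the whole ladder lies in F, excluding Y_k and Y'_k leaves at most two of the four end arcs
-- in F; otherwise the ladder misses a level.  Either way, counting ladder arcs twice, a window
-- carries weight at most 2(k-1), and summing over the N windows counts every arc of every level
-- exactly twice.  On an extreme level 0 or n the unique interval ∅ or [n] is counted once rather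
-- than N times; charging it to every window costs N ≥ 2 times as much, which is affordable.

module Submission where

open import Defs
open import Algebra.Properties.CommutativeSemigroup using (interchange; x∙yz≈y∙xz)
open import Data.Bool using (Bool; true; false; T; _∧_)
open import Data.Bool.Properties using (T-∧; T?)
open import Data.Empty using (⊥-elim)
open import Data.Fin using (Fin; zero; suc; toℕ)
open import Data.Fin.Properties using (toℕ-fromℕ<; toℕ-injective; toℕ<n; toℕ≤pred[n]; toℕ≤n)
open import Data.Fin.Permutation using (Permutation′; _⟨$⟩ʳ_; _⟨$⟩ˡ_; inverseˡ)
open import Data.Fin.Subset using (Subset; ⋃; ⊥; ⊤; ⁅_⁆; _∪_; _⊂_; _⊆_; _∈_; _∉_; ∣_∣)
open import Data.Fin.Subset.Properties
  using (x∈⁅x⁆; x∈⁅y⁆⇒x≡y; q⊆p∪q; x∈p∪q⁻; x∈p∪q⁺; ∉⊥; ∣p∣≡n⇒p≡⊤; ∣⊥∣≡0; ∪-identityˡ; ∪-assoc; ∪-comm)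
open import Data.List using (List; []; _∷_; _∷ʳ_; map; upTo; applyUpTo; filterᵇ; length; allFin)
open import Data.List.Properties using (length-removeAt′; map-upTo; map-applyUpTo; applyUpTo-∷ʳ)
open import Data.List.Membership.Propositional using (_─_) renaming (_∈_ to _∈ₗ_)
open import Data.List.Membership.Propositional.Properties using (∈-map⁻; ∈-filter⁺; ∈-filter⁻; ∈-applyUpTo⁺)
open import Data.List.Relation.Binary.Subset.Propositional using () renaming (_⊆_ to _⊆ₗ_)
open import Data.List.Relation.Unary.All as All using ([])
open import Data.List.Relation.Unary.AllPairs using ([]; _∷_)
open import Data.List.Relation.Unary.Any using (here; there; satisfied)
open import Data.List.Relation.Unary.Any.Properties using (any⁻)
open import Data.List.Relation.Unary.Unique.Propositional using (Unique)
open import Data.List.Relation.Unary.Unique.Propositional.Properties using (map⁺; ++⁺; filter⁺)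
open import Data.Nat using (ℕ; zero; suc; _+_; _*_; _∸_; _≤_; _<_; z≤n; s≤s; s≤s⁻¹; NonZero)
open import Data.Nat.Divisibility using (divides; n∣m*n; ∣m+n∣m⇒∣n; ∣⇒≤)
open import Data.Nat.DivMod using (_mod_; _%_; _/_; m≡m%n+[m/n]*n; m%n<n; [m+n]%n≡m%n)
open import Data.Nat.ListAction using (sum)
open import Data.Nat.Properties
open import Data.Nat.Tactic.RingSolver using (solve-∀)
open import Data.Product using (∃; _×_; _,_; proj₁; proj₂)
open import Data.Sum using (_⊎_; inj₁; inj₂)
import Data.Sum as Sum
open import Data.Vec using ([]; _∷_; here; there)
open import Data.Vec.Properties using (∷-injectiveʳ)
open import Function using (_∘_; _∘′_; Equivalence)
open import Relation.Binary.PropositionalEquality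
open import Relation.Nullary using (¬_)
open import Relation.Nullary.Decidable using (toWitness)

∈-─ : ∀ {A : Set} {x y : A} {xs} (x∈xs : x ∈ₗ xs) → y ∈ₗ xs → y ≢ x → y ∈ₗ (xs ─ x∈xs)
∈-─ (here refl) (here refl) y≢x = ⊥-elim (y≢x refl)
∈-─ (here refl) (there y∈xs) _  = y∈xs
∈-─ (there _)   (here refl) _   = here refl
∈-─ (there x∈xs) (there y∈xs) y≢x = there (∈-─ x∈xs y∈xs y≢x)

unique-⊆⇒length≤ : ∀ {A : Set} {xs ys : List A} → Unique xs → xs ⊆ₗ ys → length xs ≤ length ys
unique-⊆⇒length≤ {xs = []} _ _ = z≤n
unique-⊆⇒length≤ {xs = x ∷ xs} {ys} (x∉xs ∷ uxs) xs⊆ys =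
  subst (suc (length xs) ≤_) (sym (length-removeAt′ ys _))
    (s≤s (unique-⊆⇒length≤ uxs xs⊆ys─x))
  where
  x∈ys = xs⊆ys (here refl)
  xs⊆ys─x : xs ⊆ₗ ys ─ x∈ys
  xs⊆ys─x y∈xs = ∈-─ x∈ys (xs⊆ys (there y∈xs)) (λ y≡x → All.lookup x∉xs y∈xs (sym y≡x))

𝟙 : Bool → ℕ
𝟙 true  = 1
𝟙 false = 0

𝟙≤1 : ∀ b → 𝟙 b ≤ 1
𝟙≤1 true  = ≤-refl
𝟙≤1 false = z≤n

length-filterᵇ : ∀ {A : Set} (p : A → Bool) xs → length (filterᵇ p xs) ≡ sum (map (𝟙 ∘ p) xs)
length-filterᵇ p [] = refl
length-filterᵇ p (x ∷ xs) with p x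
... | true  = cong suc (length-filterᵇ p xs)
... | false = length-filterᵇ p xs

∑< : ℕ → (ℕ → ℕ) → ℕ
∑< n f = sum (applyUpTo f n)

syntax ∑< n (λ u → e) = ∑[ u < n ] e

Periodic : ℕ → (ℕ → ℕ) → Set
Periodic n f = ∀ u → f (u + n) ≡ f u

∑-cong : ∀ {f g : ℕ → ℕ} → (∀ u → f u ≡ g u) → ∀ n → ∑[ u < n ] f u ≡ ∑[ u < n ] g u
∑-cong f≗g zero    = refl
∑-cong f≗g (suc n) = cong₂ _+_ (f≗g 0) (∑-cong (f≗g ∘ suc) n)

∑-mono-≤ : ∀ {f g : ℕ → ℕ} → (∀ u → f u ≤ g u) → ∀ n → ∑[ u < n ] f u ≤ ∑[ u < n ] g u
∑-mono-≤ f≤g zero    = z≤n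
∑-mono-≤ f≤g (suc n) = +-mono-≤ (f≤g 0) (∑-mono-≤ (f≤g ∘ suc) n)

∑-distrib-+ : ∀ (f g : ℕ → ℕ) n → ∑[ u < n ] (f u + g u) ≡ ∑[ u < n ] f u + ∑[ u < n ] g u
∑-distrib-+ f g zero    = refl
∑-distrib-+ f g (suc n) =
  trans (cong (f 0 + g 0 +_) (∑-distrib-+ (f ∘ suc) (g ∘ suc) n)) (interchange +-commutativeSemigroup (f 0) (g 0) _ _)

∑-const : ∀ c n → ∑[ u < n ] c ≡ n * c
∑-const c zero    = refl
∑-const c (suc n) = cong (c +_) (∑-const c n)

∑-*ˡ : ∀ c (f : ℕ → ℕ) n → ∑[ u < n ] (c * f u) ≡ c * ∑[ u < n ] f u
∑-*ˡ c f zero    = sym (*-zeroʳ c)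
∑-*ˡ c f (suc n) = trans (cong (c * f 0 +_) (∑-*ˡ c (f ∘ suc) n)) (sym (*-distribˡ-+ c (f 0) _))

∑-comm : ∀ (h : ℕ → ℕ → ℕ) m n → ∑[ r < m ] ∑[ u < n ] h r u ≡ ∑[ u < n ] ∑[ r < m ] h r u
∑-comm h zero    n = sym (trans (∑-const 0 n) (*-zeroʳ n))
∑-comm h (suc m) n = trans (cong (∑< n (h 0) +_) (∑-comm (h ∘ suc) m n))
                           (sym (∑-distrib-+ (h 0) (λ u → ∑[ r < m ] h (suc r) u) n))

∑-suc : ∀ (f : ℕ → ℕ) n → ∑[ u < suc n ] f u ≡ ∑[ u < n ] f u + f n
∑-suc f zero    = +-comm (f 0) 0
∑-suc f (suc n) = trans (cong (f 0 +_) (∑-suc (f ∘ suc) n)) (sym (+-assoc (f 0) _ _))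

∑-rotate : ∀ {f : ℕ → ℕ} n → Periodic n f → ∑[ u < n ] f (suc u) ≡ ∑[ u < n ] f u
∑-rotate {f} n f-periodic = +-cancelʳ-≡ (f 0) _ _ (begin
  ∑[ u < n ] f (suc u) + f 0  ≡⟨ +-comm _ (f 0) ⟩
  ∑[ u < suc n ] f u          ≡⟨ ∑-suc f n ⟩
  ∑[ u < n ] f u + f n        ≡⟨ cong (∑< n f +_) (f-periodic 0) ⟩
  ∑[ u < n ] f u + f 0        ∎)
  where open ≡-Reasoning

∑-pair : ∀ {f : ℕ → ℕ} n → Periodic n f → ∑[ u < n ] (f u + f (suc u)) ≡ 2 * ∑[ u < n ] f u
∑-pair {f} n f-periodic = begin
  ∑[ u < n ] (f u + f (suc u))          ≡⟨ ∑-distrib-+ f (f ∘ suc) n ⟩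
  ∑[ u < n ] f u + ∑[ u < n ] f (suc u) ≡⟨ cong (∑< n f +_) (∑-rotate n f-periodic) ⟩
  ∑[ u < n ] f u + ∑[ u < n ] f u       ≡⟨ cong (∑< n f +_) (sym (+-identityʳ _)) ⟩
  2 * ∑[ u < n ] f u                    ∎
  where open ≡-Reasoning

∑𝟙≤ : ∀ (p : ℕ → Bool) n → ∑[ u < n ] 𝟙 (p u) ≤ n
∑𝟙≤ p zero    = z≤n
∑𝟙≤ p (suc n) = +-mono-≤ (𝟙≤1 (p 0)) (∑𝟙≤ (p ∘ suc) n)

∑𝟙-all⊎< : ∀ (p : ℕ → Bool) n → (∀ u → u < n → T (p u)) ⊎ ∑[ u < n ] 𝟙 (p u) < n
∑𝟙-all⊎< p zero = inj₁ (λ _ ())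
∑𝟙-all⊎< p (suc n) with p 0 in p0 | ∑𝟙-all⊎< (p ∘ suc) n
... | true  | inj₁ all = inj₁ λ { zero _ → subst T (sym p0) _ ; (suc u) (s≤s u<n) → all u u<n }
... | true  | inj₂ lt  = inj₂ (s≤s lt)
... | false | _        = inj₂ (s≤s (∑𝟙≤ (p ∘ suc) n))

-- The windows count each β-, μ- and τ-term twice and d n times; 2 ≤ n lets n·d pay for 2·d.
double-count : ∀ {n c d} {β μ τ : ℕ → ℕ} → 2 ≤ n →
  Periodic n β → Periodic n μ → Periodic n τ →
  (∀ u → τ u + τ (suc u) + (d + (β (suc u) + β (suc (suc u)))) + 2 * μ (suc u) ≤ 2 * c) →
  d + (∑[ u < n ] β u + (∑[ u < n ] μ u + ∑[ u < n ] τ u)) ≤ n * c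
double-count {n} {c} {d} {β} {μ} {τ} 2≤n β-periodic μ-periodic τ-periodic window =
  *-cancelˡ-≤ 2 (begin
    2 * (d + (Σβ + (Σμ + Στ)))           ≡⟨ regroup d Σβ Σμ Στ ⟩
    2 * d + (2 * Στ + 2 * Σβ + 2 * Σμ)   ≤⟨ +-monoˡ-≤ _ (*-monoˡ-≤ d 2≤n) ⟩
    n * d + (2 * Στ + 2 * Σβ + 2 * Σμ)   ≡⟨ sym total ⟩
    ∑[ u < n ] w u                       ≤⟨ ∑-mono-≤ window n ⟩
    ∑[ u < n ] (2 * c)                   ≡⟨ ∑-const (2 * c) n ⟩
    n * (2 * c)                          ≡⟨ x∙yz≈y∙xz *-commutativeSemigroup n 2 c ⟩
    2 * (n * c)                          ∎)
  where
  open ≤-Reasoning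
  Σβ = ∑[ u < n ] β u
  Σμ = ∑[ u < n ] μ u
  Στ = ∑[ u < n ] τ u
  β² w : ℕ → ℕ
  β² u = β (suc u) + β (suc (suc u))
  w u = τ u + τ (suc u) + (d + β² u) + 2 * μ (suc u)
  regroup : ∀ d b m t → 2 * (d + (b + (m + t))) ≡ 2 * d + (2 * t + 2 * b + 2 * m)
  regroup = solve-∀
  total : ∑[ u < n ] w u ≡ n * d + (2 * Στ + 2 * Σβ + 2 * Σμ)
  total = begin-equality
    ∑[ u < n ] w u
      ≡⟨ trans (∑-distrib-+ (λ u → τ u + τ (suc u) + (d + β² u)) (λ u → 2 * μ (suc u)) n)
               (cong (_+ _) (trans (∑-distrib-+ (λ u → τ u + τ (suc u)) (λ u → d + β² u) n)
                                   (cong (_ +_) (∑-distrib-+ (λ _ → d) β² n)))) ⟩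
    ∑[ u < n ] (τ u + τ (suc u)) + (∑[ u < n ] d + ∑[ u < n ] β² u) + ∑[ u < n ] (2 * μ (suc u))
      ≡⟨ cong₂ _+_ (cong₂ _+_ (∑-pair n τ-periodic)
                              (cong₂ _+_ (∑-const d n)
                                         (trans (∑-pair n (β-periodic ∘ suc)) (cong (2 *_) (∑-rotate n β-periodic)))))
                   (trans (∑-*ˡ 2 (μ ∘ suc) n) (cong (2 *_) (∑-rotate n μ-periodic))) ⟩
    2 * Στ + (n * d + 2 * Σβ) + 2 * Σμ
      ≡⟨ shuffle Στ (n * d) Σβ Σμ ⟩
    n * d + (2 * Στ + 2 * Σβ + 2 * Σμ) ∎
    where
    shuffle : ∀ t e b m → 2 * t + (e + 2 * b) + 2 * m ≡ e + (2 * t + 2 * b + 2 * m)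
    shuffle = solve-∀

𝟙+𝟙≡0 : ∀ {a b} → ¬ (T a ⊎ T b) → 𝟙 a + 𝟙 b ≡ 0
𝟙+𝟙≡0 {true}          ¬a∨b = ⊥-elim (¬a∨b (inj₁ _))
𝟙+𝟙≡0 {false} {true}  ¬a∨b = ⊥-elim (¬a∨b (inj₂ _))
𝟙+𝟙≡0 {false} {false} _    = refl

𝟙+𝟙≤1 : ∀ {a b} → (T a → ¬ T b) → 𝟙 a + 𝟙 b ≤ 1
𝟙+𝟙≤1 {true}  {true}  ¬a∧b = ⊥-elim (¬a∧b _ _)
𝟙+𝟙≤1 {true}  {false} _    = ≤-refl
𝟙+𝟙≤1 {false} {b}     _    = 𝟙≤1 b

at-most-two : ∀ a₁ a₂ b₁ b₂ →
              (T a₁ → T a₂ → ¬ (T b₁ ⊎ T b₂)) → (T b₁ → T b₂ → ¬ (T a₁ ⊎ T a₂)) →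
              𝟙 a₁ + 𝟙 a₂ + (𝟙 b₁ + 𝟙 b₂) ≤ 2
at-most-two true  true  _  _  ¬b _  = ≤-reflexive (cong (2 +_) (𝟙+𝟙≡0 (¬b _ _)))
at-most-two true  false _  _  _  ¬a = s≤s (𝟙+𝟙≤1 λ b₁ b₂ → ¬a b₁ b₂ (inj₁ _))
at-most-two false true  _  _  _  ¬a = s≤s (𝟙+𝟙≤1 λ b₁ b₂ → ¬a b₁ b₂ (inj₂ _))
at-most-two false false b₁ b₂ _  _  = +-mono-≤ (𝟙≤1 b₁) (𝟙≤1 b₂)

record Ladder {n} (F : Family n) (b h : ℕ) (L : ℕ → Subset n) : Set where
  field
    ladder-∈F  : ∀ r → r ≤ h → T (F (L r))
    ladder-∣∣  : ∀ r → r ≤ h → ∣ L r ∣ ≡ b + suc r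
    ladder-⊂   : ∀ r → r < h → L r ⊂ L (suc r)

module _ {n} {F : Family n} {b h} {L : ℕ → Subset n} (ladder : Ladder F b h L) where
  open Ladder ladder

  ladder⇒Y : ∀ {S S₁ S₂} → T (F S) → ∣ S ∣ ≡ b → S ⊂ L 0 →
    T (F S₁) → T (F S₂) → S₁ ≢ S₂ → ∣ S₁ ∣ ≡ b + suc (suc h) → ∣ S₂ ∣ ≡ b + suc (suc h) →
    L h ⊂ S₁ → L h ⊂ S₂ → ContainsY (suc (suc (suc h))) F
  ladder⇒Y {S} {S₁} {S₂} S∈F ∣S∣ S⊂L₀ S₁∈F S₂∈F S₁≢S₂ ∣S₁∣ ∣S₂∣ L⊂S₁ L⊂S₂ =
    S₁ , S₂ , G , (S₁∈F , S₂∈F , G∈F) , (S₁≢S₂ , G-injective , G≢ ∣S₁∣ , G≢ ∣S₂∣) ,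
    G-⊂ , G⊂top , (trans ∣S₁∣ (sym ∣S₂∣) , G-∣∣+gap)
    where
    G : Fin (suc (suc h)) → Subset n
    G zero    = S
    G (suc j) = L (toℕ j)
    G∈F : ∀ j → T (F (G j))
    G∈F zero    = S∈F
    G∈F (suc j) = ladder-∈F (toℕ j) (toℕ≤pred[n] j)
    ∣G∣ : ∀ j → ∣ G j ∣ ≡ b + toℕ j
    ∣G∣ zero    = trans ∣S∣ (sym (+-identityʳ b))
    ∣G∣ (suc j) = ladder-∣∣ (toℕ j) (toℕ≤pred[n] j)
    G-injective : ∀ i j → G i ≡ G j → i ≡ j
    G-injective i j Gi≡Gj =
      toℕ-injective (+-cancelˡ-≡ b _ _ (trans (sym (∣G∣ i)) (trans (cong ∣_∣ Gi≡Gj) (∣G∣ j))))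
    G≢ : ∀ {S′} → ∣ S′ ∣ ≡ b + suc (suc h) → ∀ j → G j ≢ S′
    G≢ ∣S′∣ j Gj≡S′ =
      <⇒≢ (+-monoʳ-< b (toℕ<n j)) (trans (sym (∣G∣ j)) (trans (cong ∣_∣ Gj≡S′) ∣S′∣))
    G-⊂ : ∀ i j → suc (toℕ i) ≡ toℕ j → G i ⊂ G j
    G-⊂ zero    (suc zero)    _  = S⊂L₀
    G-⊂ (suc i) (suc j)       eq =
      subst (λ r → L (toℕ i) ⊂ L r) (suc-injective eq)
        (ladder-⊂ (toℕ i) (subst (_≤ h) (sym (suc-injective eq)) (toℕ≤pred[n] j)))
    G-⊂ zero    zero          ()
    G-⊂ zero    (suc (suc _)) ()
    G-⊂ (suc _) zero          ()
    G⊂top : ∀ j → suc (toℕ j) ≡ suc (suc h) → G j ⊂ S₁ × G j ⊂ S₂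
    G⊂top zero    ()
    G⊂top (suc j) eq =
      subst (λ r → L r ⊂ S₁ × L r ⊂ S₂) (sym (suc-injective (suc-injective eq))) (L⊂S₁ , L⊂S₂)
    G-∣∣+gap : ∀ j → ∣ G j ∣ + (suc (suc h) ∸ toℕ j) ≡ ∣ S₁ ∣
    G-∣∣+gap j = begin
      ∣ G j ∣ + (suc (suc h) ∸ toℕ j)   ≡⟨ cong (_+ _) (∣G∣ j) ⟩
      b + toℕ j + (suc (suc h) ∸ toℕ j) ≡⟨ +-assoc b (toℕ j) _ ⟩
      b + (toℕ j + (suc (suc h) ∸ toℕ j)) ≡⟨ cong (b +_) (m+[n∸m]≡n (toℕ≤n j)) ⟩
      b + suc (suc h)                   ≡⟨ sym ∣S₁∣ ⟩
      ∣ S₁ ∣                            ∎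
      where open ≡-Reasoning

  ladder⇒Y′ : ∀ {S S₁ S₂} → T (F S) → ∣ S ∣ ≡ b + suc (suc h) → L h ⊂ S →
    T (F S₁) → T (F S₂) → S₁ ≢ S₂ → ∣ S₁ ∣ ≡ b → ∣ S₂ ∣ ≡ b →
    S₁ ⊂ L 0 → S₂ ⊂ L 0 → ContainsY′ (suc (suc (suc h))) F
  ladder⇒Y′ {S} {S₁} {S₂} S∈F ∣S∣ L⊂S S₁∈F S₂∈F S₁≢S₂ ∣S₁∣ ∣S₂∣ S₁⊂L₀ S₂⊂L₀ =
    S₁ , S₂ , G , (S₁∈F , S₂∈F , G∈F) , (S₁≢S₂ , G-injective , G≢ ∣S₁∣ , G≢ ∣S₂∣) ,
    G-⊃ , bottom⊂G , (trans ∣S₁∣ (sym ∣S₂∣) , ∣S₁∣+gap)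
    where
    G : Fin (suc (suc h)) → Subset n
    G zero    = S
    G (suc j) = L (h ∸ toℕ j)
    G∈F : ∀ j → T (F (G j))
    G∈F zero    = S∈F
    G∈F (suc j) = ladder-∈F (h ∸ toℕ j) (m∸n≤m h (toℕ j))
    ∣G∣ : ∀ j → ∣ G j ∣ ≡ b + (suc (suc h) ∸ toℕ j)
    ∣G∣ zero    = ∣S∣
    ∣G∣ (suc j) = trans (ladder-∣∣ (h ∸ toℕ j) (m∸n≤m h (toℕ j)))
                        (cong (b +_) (sym (+-∸-assoc 1 (toℕ≤pred[n] j))))
    G-injective : ∀ i j → G i ≡ G j → i ≡ j
    G-injective i j Gi≡Gj = toℕ-injective (∸-cancelˡ-≡ (toℕ≤n i) (toℕ≤n j)
      (+-cancelˡ-≡ b _ _ (trans (sym (∣G∣ i)) (trans (cong ∣_∣ Gi≡Gj) (∣G∣ j)))))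
    G≢ : ∀ {S′} → ∣ S′ ∣ ≡ b → ∀ j → G j ≢ S′
    G≢ {S′} ∣S′∣ j Gj≡S′ = m≢1+m+n b (begin
      b                               ≡⟨ sym ∣S′∣ ⟩
      ∣ S′ ∣                          ≡⟨ cong ∣_∣ Gj≡S′ ⟨
      ∣ G j ∣                         ≡⟨ ∣G∣ j ⟩
      b + (suc (suc h) ∸ toℕ j)       ≡⟨ cong (b +_) (+-∸-assoc 1 (toℕ≤pred[n] j)) ⟩
      b + suc (suc h ∸ toℕ j)         ≡⟨ +-suc b _ ⟩
      suc (b + (suc h ∸ toℕ j))       ∎)
      where open ≡-Reasoning
    G-⊃ : ∀ i j → suc (toℕ i) ≡ toℕ j → G j ⊂ G i
    G-⊃ zero    (suc zero)    _  = L⊂S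
    G-⊃ (suc i) (suc j)       eq =
      subst (λ r → L (h ∸ toℕ j) ⊂ L r) (sym h∸i≡1+h∸j)
        (ladder-⊂ (h ∸ toℕ j) (∸-monoʳ-< (subst (0 <_) (suc-injective eq) (s≤s z≤n)) j≤h′))
      where
      j≤h′ : toℕ j ≤ h
      j≤h′ = toℕ≤pred[n] j
      h∸i≡1+h∸j : h ∸ toℕ i ≡ suc (h ∸ toℕ j)
      h∸i≡1+h∸j = subst (λ r → h ∸ toℕ i ≡ suc (h ∸ r)) (suc-injective eq)
                    (+-∸-assoc 1 (subst (_≤ h) (sym (suc-injective eq)) j≤h′))
    G-⊃ zero    zero          ()
    G-⊃ zero    (suc (suc _)) ()
    G-⊃ (suc _) zero          ()
    bottom⊂G : ∀ j → suc (toℕ j) ≡ suc (suc h) → S₁ ⊂ G j × S₂ ⊂ G j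
    bottom⊂G zero    ()
    bottom⊂G (suc j) eq = subst (λ r → S₁ ⊂ L r × S₂ ⊂ L r) h∸j≡0 (S₁⊂L₀ , S₂⊂L₀)
      where
      h∸j≡0 : 0 ≡ h ∸ toℕ j
      h∸j≡0 = trans (sym (n∸n≡0 h)) (cong (h ∸_) (sym (suc-injective (suc-injective eq))))
    ∣S₁∣+gap : ∀ j → ∣ S₁ ∣ + (suc (suc h) ∸ toℕ j) ≡ ∣ G j ∣
    ∣S₁∣+gap j = trans (cong (_+ _) ∣S₁∣) (sym (∣G∣ j))

[m+d]%n≢m%n : ∀ m {d} n .{{_ : NonZero n}} → 0 < d → d < n → (m + d) % n ≢ m % n
[m+d]%n≢m%n m {d@(suc _)} n _ d<n eq = <⇒≱ d<n (∣⇒≤ n∣d)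
  where
  open ≡-Reasoning
  q*n+d≡q′*n : m / n * n + d ≡ (m + d) / n * n
  q*n+d≡q′*n = +-cancelˡ-≡ (m % n) _ _ (begin
    m % n + (m / n * n + d)       ≡⟨ +-assoc (m % n) _ d ⟨
    m % n + m / n * n + d         ≡⟨ cong (_+ d) (m≡m%n+[m/n]*n m n) ⟨
    m + d                         ≡⟨ m≡m%n+[m/n]*n (m + d) n ⟩
    (m + d) % n + (m + d) / n * n ≡⟨ cong (_+ (m + d) / n * n) eq ⟩
    m % n + (m + d) / n * n       ∎)
  n∣d = ∣m+n∣m⇒∣n (divides ((m + d) / n) q*n+d≡q′*n) (n∣m*n (m / n))

x∉p⇒∣⁅x⁆∪p∣≡1+∣p∣ : ∀ {n} {x : Fin n} {p} → x ∉ p → ∣ ⁅ x ⁆ ∪ p ∣ ≡ suc ∣ p ∣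
x∉p⇒∣⁅x⁆∪p∣≡1+∣p∣ {x = zero}  {true  ∷ p} x∉p = ⊥-elim (x∉p here)
x∉p⇒∣⁅x⁆∪p∣≡1+∣p∣ {x = zero}  {false ∷ p} _   = cong (suc ∘′ ∣_∣) (∪-identityˡ p)
x∉p⇒∣⁅x⁆∪p∣≡1+∣p∣ {x = suc x} {true  ∷ p} x∉p = cong suc (x∉p⇒∣⁅x⁆∪p∣≡1+∣p∣ (x∉p ∘′ there))
x∉p⇒∣⁅x⁆∪p∣≡1+∣p∣ {x = suc x} {false ∷ p} x∉p = x∉p⇒∣⁅x⁆∪p∣≡1+∣p∣ (x∉p ∘′ there)

⋃-∷ʳ : ∀ {n} (ps : List (Subset n)) p → ⋃ (ps ∷ʳ p) ≡ p ∪ ⋃ ps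
⋃-∷ʳ []       p = refl
⋃-∷ʳ (q ∷ ps) p = begin
  q ∪ ⋃ (ps ∷ʳ p)  ≡⟨ cong (q ∪_) (⋃-∷ʳ ps p) ⟩
  q ∪ (p ∪ ⋃ ps)   ≡⟨ ∪-assoc q p _ ⟨
  (q ∪ p) ∪ ⋃ ps   ≡⟨ cong (_∪ ⋃ ps) (∪-comm q p) ⟩
  (p ∪ q) ∪ ⋃ ps   ≡⟨ ∪-assoc p q _ ⟩
  p ∪ (q ∪ ⋃ ps)   ∎
  where open ≡-Reasoning

allSubsets-unique : ∀ n → Unique (allSubsets n)
allSubsets-unique zero    = [] ∷ []
allSubsets-unique (suc n) =
  ++⁺ (map⁺ ∷-injectiveʳ (allSubsets-unique n)) (map⁺ ∷-injectiveʳ (allSubsets-unique n)) heads-differ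
  where
  heads-differ : ∀ {p} → ¬ (p ∈ₗ map (true ∷_) (allSubsets n) × p ∈ₗ map (false ∷_) (allSubsets n))
  heads-differ (p∈ , p∈′) with ∈-map⁻ (true ∷_) p∈ | ∈-map⁻ (false ∷_) p∈′
  ... | _ , _ , refl | _ , _ , ()

module Arcs {m} (σ : Permutation′ (suc m)) where

  N : ℕ
  N = suc m

  a : ℕ → Fin N
  a u = σ ⟨$⟩ʳ (u mod N)

  arc : ℕ → ℕ → Subset N
  arc v zero    = ⊥
  arc v (suc s) = ⁅ a (v + s) ⁆ ∪ arc v s

  toℕ-mod : ∀ u → toℕ (u mod N) ≡ u % N
  toℕ-mod u = toℕ-fromℕ< (m%n<n u N)

  a-periodic : ∀ u → a (u + N) ≡ a u
  a-periodic u =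
    cong (σ ⟨$⟩ʳ_) (toℕ-injective (trans (toℕ-mod (u + N)) (trans ([m+n]%n≡m%n u N) (sym (toℕ-mod u)))))

  a-injective : ∀ v {r s} → r < s → s < N → a (v + r) ≢ a (v + s)
  a-injective v {r} {s} r<s s<N a[v+r]≡a[v+s] =
    [m+d]%n≢m%n (v + r) N (m<n⇒0<n∸m r<s) (≤-<-trans (m∸n≤m s r) s<N) (begin
      (v + r + (s ∸ r)) % N ≡⟨ cong (_% N) (trans (+-assoc v r _) (cong (v +_) (m+[n∸m]≡n (<⇒≤ r<s)))) ⟩
      (v + s) % N           ≡⟨ toℕ-mod (v + s) ⟨
      toℕ ((v + s) mod N)   ≡⟨ cong toℕ σ-injective ⟨
      toℕ ((v + r) mod N)   ≡⟨ toℕ-mod (v + r) ⟩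
      (v + r) % N           ∎)
    where
    open ≡-Reasoning
    σ-injective : (v + r) mod N ≡ (v + s) mod N
    σ-injective = trans (sym (inverseˡ σ)) (trans (cong (σ ⟨$⟩ˡ_) a[v+r]≡a[v+s]) (inverseˡ σ))

  ∈-arc⁺ : ∀ {v r s} → r < s → a (v + r) ∈ arc v s
  ∈-arc⁺ {v} {r} {suc s} r<1+s with m≤n⇒m<n∨m≡n (s≤s⁻¹ r<1+s)
  ... | inj₁ r<s  = x∈p∪q⁺ (inj₂ (∈-arc⁺ r<s))
  ... | inj₂ refl = x∈p∪q⁺ (inj₁ (x∈⁅x⁆ _))

  ∈-arc⁻ : ∀ {v s y} → y ∈ arc v s → ∃ λ r → r < s × y ≡ a (v + r)
  ∈-arc⁻ {s = zero}  y∈ = ⊥-elim (∉⊥ y∈)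
  ∈-arc⁻ {v} {suc s} y∈ with x∈p∪q⁻ ⁅ a (v + s) ⁆ (arc v s) y∈
  ... | inj₁ y∈⁅a⁆ = s , ≤-refl , x∈⁅y⁆⇒x≡y _ y∈⁅a⁆
  ... | inj₂ y∈arc = let r , r<s , y≡a = ∈-arc⁻ y∈arc in r , m<n⇒m<1+n r<s , y≡a

  a∉arc : ∀ {v s} → s < N → a (v + s) ∉ arc v s
  a∉arc {v} s<N a∈arc = let r , r<s , a≡a = ∈-arc⁻ a∈arc in a-injective v r<s s<N (sym a≡a)

  a∉arc-suc : ∀ {v s} → s < N → a (v + 0) ∉ arc (suc v) s
  a∉arc-suc {v} s<N a∈arc = let r , r<s , a≡a = ∈-arc⁻ a∈arc in
    a-injective v (s≤s z≤n) (≤-<-trans r<s s<N) (trans a≡a (cong a (sym (+-suc v r))))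

  ∣arc∣ : ∀ {v s} → s ≤ N → ∣ arc v s ∣ ≡ s
  ∣arc∣ {s = zero}  _     = ∣⊥∣≡0 N
  ∣arc∣ {s = suc s} 1+s≤N =
    trans (x∉p⇒∣⁅x⁆∪p∣≡1+∣p∣ (a∉arc 1+s≤N)) (cong suc (∣arc∣ (<⇒≤ 1+s≤N)))

  arc⊂arc-suc : ∀ {v s} → s < N → arc v s ⊂ arc v (suc s)
  arc⊂arc-suc {v} {s} s<N = q⊆p∪q _ (arc v s) , a (v + s) , x∈p∪q⁺ (inj₁ (x∈⁅x⁆ _)) , a∉arc s<N

  arc-suc⊂arc : ∀ {v s} → s < N → arc (suc v) s ⊂ arc v (suc s)
  arc-suc⊂arc {v} {s} s<N = arc-suc⊆arc , a (v + 0) , ∈-arc⁺ {v} (s≤s z≤n) , a∉arc-suc s<N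
    where
    arc-suc⊆arc : arc (suc v) s ⊆ arc v (suc s)
    arc-suc⊆arc y∈ = let r , r<s , y≡a = ∈-arc⁻ {suc v} {s} y∈ in
      subst (_∈ arc v (suc s)) (sym (trans y≡a (cong a (sym (+-suc v r))))) (∈-arc⁺ {v} (s≤s r<s))

  arc≢arc-suc : ∀ {v s} → 0 < s → s < N → arc v s ≢ arc (suc v) s
  arc≢arc-suc {v} {s} 0<s s<N eq = a∉arc-suc {v} s<N (subst (a (v + 0) ∈_) eq (∈-arc⁺ {v} 0<s))

  arc-periodic : ∀ v s → arc (v + N) s ≡ arc v s
  arc-periodic v zero    = refl
  arc-periodic v (suc s) = cong₂ (λ x p → ⁅ x ⁆ ∪ p) a-shift (arc-periodic v s)
    where
    a-shift : a (v + N + s) ≡ a (v + s)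
    a-shift = trans (cong a (trans (+-assoc v N s) (trans (cong (v +_) (+-comm N s)) (sym (+-assoc v s N)))))
                    (a-periodic (v + s))

  arc-full : ∀ v → arc v N ≡ ⊤
  arc-full v = ∣p∣≡n⇒p≡⊤ (∣arc∣ ≤-refl)

  interval≡arc : ∀ t s → interval σ t s ≡ arc (toℕ t) s
  interval≡arc t s = trans (cong ⋃ (map-upTo h s)) (⋃-applyUpTo s)
    where
    h : ℕ → Subset N
    h r = ⁅ a (toℕ t + r) ⁆
    ⋃-applyUpTo : ∀ s → ⋃ (applyUpTo h s) ≡ arc (toℕ t) s
    ⋃-applyUpTo zero    = refl
    ⋃-applyUpTo (suc s) = begin
      ⋃ (applyUpTo h (suc s))      ≡⟨ cong ⋃ (applyUpTo-∷ʳ h s) ⟨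
      ⋃ (applyUpTo h s ∷ʳ h s)     ≡⟨ ⋃-∷ʳ (applyUpTo h s) (h s) ⟩
      h s ∪ ⋃ (applyUpTo h s)      ≡⟨ cong (h s ∪_) (⋃-applyUpTo s) ⟩
      h s ∪ arc (toℕ t) s          ∎
      where open ≡-Reasoning

  module _ (F : Family N) where

    x≤length-filter : ∀ {s} (C : List (Subset N)) → (∀ t → interval σ t s ∈ₗ C) →
                      x σ F s ≤ length (filterᵇ F C)
    x≤length-filter {s} C intervals∈C =
      unique-⊆⇒length≤ (filter⁺ (T? ∘ (λ S → F S ∧ isIntervalᵇ σ s S)) (allSubsets-unique N)) ⊆filter
      where
      ⊆filter : filterᵇ (λ S → F S ∧ isIntervalᵇ σ s S) (allSubsets N) ⊆ₗ filterᵇ F C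
      ⊆filter S∈ with ∈-filter⁻ (T? ∘ (λ S → F S ∧ isIntervalᵇ σ s S)) {xs = allSubsets N} S∈
      ... | _ , S∈F∧S-interval with Equivalence.to T-∧ S∈F∧S-interval
      ...   | S∈F , S-interval with satisfied (any⁻ _ (allFin N) S-interval)
      ...     | t , t-interval≡S =
        ∈-filter⁺ (T? ∘ F) (subst (_∈ₗ C) (toWitness t-interval≡S) (intervals∈C t)) S∈F

    x≤∑ : ∀ s → x σ F s ≤ ∑[ u < N ] 𝟙 (F (arc u s))
    x≤∑ s = subst (x σ F s ≤_) count (x≤length-filter {s} arcs interval∈arcs)
      where
      arcs = applyUpTo (λ u → arc u s) N
      interval∈arcs : ∀ t → interval σ t s ∈ₗ arcs
      interval∈arcs t = subst (_∈ₗ arcs) (sym (interval≡arc t s)) (∈-applyUpTo⁺ (λ u → arc u s) (toℕ<n t))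
      count : length (filterᵇ F arcs) ≡ ∑[ u < N ] 𝟙 (F (arc u s))
      count = trans (length-filterᵇ F _) (cong sum (map-applyUpTo (λ u → arc u s) (𝟙 ∘′ F) N))

    x≤𝟙 : ∀ {s S} → (∀ t → interval σ t s ≡ S) → x σ F s ≤ 𝟙 (F S)
    x≤𝟙 {s} {S} intervals≡S = subst (x σ F s ≤_) (trans (length-filterᵇ F (S ∷ [])) (+-identityʳ _))
      (x≤length-filter {s} (S ∷ []) (λ t → here (intervals≡S t)))

module Windows {m} (σ : Permutation′ (suc m)) (F : Family (suc m)) (k′ : ℕ)
  (k≤N : suc (suc (suc k′)) ≤ suc m)
  (noY : ¬ ContainsY (suc (suc (suc k′))) F) (noY′ : ¬ ContainsY′ (suc (suc (suc k′))) F) where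

  open Arcs σ

  C : ℕ
  C = suc (suc k′)

  module Levels (i : ℕ) where

    top bot : ℕ → Bool
    top u = F (arc u (i + C))
    bot u = F (arc u i)

    mid : ℕ → ℕ
    mid u = ∑[ r < suc k′ ] 𝟙 (F (arc u (i + suc r)))

    Full : ℕ → Set
    Full u = ∀ r → r < suc k′ → T (F (arc u (i + suc r)))

    module _ (i+C≤N : i + C ≤ N) where

      i<N : i < N
      i<N = <-≤-trans (m<m+n i (s≤s z≤n)) i+C≤N

      i+1+k′<N : i + suc k′ < N
      i+1+k′<N = <-≤-trans (+-monoʳ-< i ≤-refl) i+C≤N

      ladder : ∀ {u} → Full u → Ladder F i k′ (λ r → arc u (i + suc r))
      ladder {u} full = record
        { ladder-∈F = λ r r≤k′ → full r (s≤s r≤k′)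
        ; ladder-∣∣ = λ r r≤k′ → ∣arc∣ (<⇒≤ (≤-<-trans (+-monoʳ-≤ i (s≤s r≤k′)) i+1+k′<N))
        ; ladder-⊂  = λ r r<k′ → subst (arc u (i + suc r) ⊂_) (cong (arc u) (sym (+-suc i (suc r))))
                                       (arc⊂arc-suc (<-trans (+-monoʳ-< i (s≤s r<k′)) i+1+k′<N))
        }

      ladder⊂tops : ∀ {u} → let L = arc (suc u) (i + suc k′) in L ⊂ arc u (i + C) × L ⊂ arc (suc u) (i + C)
      ladder⊂tops {u} = subst (λ s → arc (suc u) (i + suc k′) ⊂ arc u s × arc (suc u) (i + suc k′) ⊂ arc (suc u) s)
        (sym (+-suc i (suc k′))) (arc-suc⊂arc i+1+k′<N , arc⊂arc-suc i+1+k′<N)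

      bottoms⊂ladder : ∀ {u} → arc (suc u) i ⊂ arc (suc u) (i + 1) × arc (suc (suc u)) i ⊂ arc (suc u) (i + 1)
      bottoms⊂ladder {u} = subst (λ s → arc (suc u) i ⊂ arc (suc u) s × arc (suc (suc u)) i ⊂ arc (suc u) s)
        (+-comm 1 i) (arc⊂arc-suc i<N , arc-suc⊂arc i<N)

      Y-above : i + C < N → ∀ {u v} → Full (suc u) → T (top u) → T (top (suc u)) →
                T (F (arc v i)) → arc v i ⊂ arc (suc u) (i + 1) → ContainsY (suc (suc (suc k′))) F
      Y-above i+C<N full top₁ top₂ bottom bottom⊂ladder =
        ladder⇒Y (ladder full) bottom (∣arc∣ (<⇒≤ i<N)) bottom⊂ladder top₁ top₂
          (arc≢arc-suc (<-≤-trans (s≤s z≤n) (m≤n+m C i)) i+C<N) (∣arc∣ i+C≤N) (∣arc∣ i+C≤N)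
          (proj₁ ladder⊂tops) (proj₂ ladder⊂tops)

      Y′-below : 0 < i → ∀ {u v} → Full (suc u) → T (bot (suc u)) → T (bot (suc (suc u))) →
                 T (F (arc v (i + C))) → arc (suc u) (i + suc k′) ⊂ arc v (i + C) →
                 ContainsY′ (suc (suc (suc k′))) F
      Y′-below 0<i full bot₁ bot₂ top top⊃ladder =
        ladder⇒Y′ (ladder full) top (∣arc∣ i+C≤N) top⊃ladder bot₁ bot₂
          (arc≢arc-suc 0<i i<N) (∣arc∣ (<⇒≤ i<N)) (∣arc∣ (<⇒≤ i<N))
          (proj₁ bottoms⊂ladder) (proj₂ bottoms⊂ladder)

    no-Y : i + C < N → ∀ {u} → Full (suc u) → T (top u) → T (top (suc u)) →
           ¬ (T (bot (suc u)) ⊎ T (bot (suc (suc u))))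
    no-Y i+C<N full top₁ top₂ (inj₁ bot₁) =
      noY (Y-above (<⇒≤ i+C<N) i+C<N full top₁ top₂ bot₁ (proj₁ (bottoms⊂ladder (<⇒≤ i+C<N))))
    no-Y i+C<N full top₁ top₂ (inj₂ bot₂) =
      noY (Y-above (<⇒≤ i+C<N) i+C<N full top₁ top₂ bot₂ (proj₂ (bottoms⊂ladder (<⇒≤ i+C<N))))

    no-Y′ : 0 < i → i + C ≤ N → ∀ {u} → Full (suc u) → T (bot (suc u)) → T (bot (suc (suc u))) →
            ¬ (T (top u) ⊎ T (top (suc u)))
    no-Y′ 0<i i+C≤N full bot₁ bot₂ (inj₁ top₁) =
      noY′ (Y′-below i+C≤N 0<i full bot₁ bot₂ top₁ (proj₁ (ladder⊂tops i+C≤N)))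
    no-Y′ 0<i i+C≤N full bot₁ bot₂ (inj₂ top₂) =
      noY′ (Y′-below i+C≤N 0<i full bot₁ bot₂ top₂ (proj₂ (ladder⊂tops i+C≤N)))

    window : ∀ u (a₁ a₂ b₁ b₂ : Bool) →
      (Full (suc u) → T a₁ → T a₂ → ¬ (T b₁ ⊎ T b₂)) →
      (Full (suc u) → T b₁ → T b₂ → ¬ (T a₁ ⊎ T a₂)) →
      𝟙 a₁ + 𝟙 a₂ + (𝟙 b₁ + 𝟙 b₂) + 2 * mid (suc u) ≤ 2 * C
    window u a₁ a₂ b₁ b₂ ¬b ¬a with ∑𝟙-all⊎< (λ r → F (arc (suc u) (i + suc r))) (suc k′)
    ... | inj₁ full = begin
      𝟙 a₁ + 𝟙 a₂ + (𝟙 b₁ + 𝟙 b₂) + 2 * mid (suc u)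
        ≤⟨ +-mono-≤ (at-most-two a₁ a₂ b₁ b₂ (¬b full) (¬a full))
                    (*-monoʳ-≤ 2 (∑𝟙≤ (λ r → F (arc (suc u) (i + suc r))) (suc k′))) ⟩
      2 + 2 * suc k′ ≡⟨ *-suc 2 (suc k′) ⟨
      2 * C          ∎
      where open ≤-Reasoning
    ... | inj₂ short = begin
      𝟙 a₁ + 𝟙 a₂ + (𝟙 b₁ + 𝟙 b₂) + 2 * mid (suc u)
        ≤⟨ +-mono-≤ (+-mono-≤ (+-mono-≤ (𝟙≤1 a₁) (𝟙≤1 a₂)) (+-mono-≤ (𝟙≤1 b₁) (𝟙≤1 b₂)))
                    (*-monoʳ-≤ 2 (s≤s⁻¹ short)) ⟩
      4 + 2 * k′     ≡⟨ trans (*-suc 2 (suc k′)) (cong (2 +_) (*-suc 2 k′)) ⟨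
      2 * C          ∎
      where open ≤-Reasoning

    𝟙-arc-periodic : ∀ s → Periodic N (λ u → 𝟙 (F (arc u s)))
    𝟙-arc-periodic s u = cong (𝟙 ∘ F) (arc-periodic u s)

    mid-periodic : Periodic N mid
    mid-periodic u = ∑-cong (λ r → 𝟙-arc-periodic (i + suc r) u) (suc k′)

    ∑x-mid≤∑mid : ∑[ r < suc k′ ] x σ F (i + suc r) ≤ ∑[ u < N ] mid u
    ∑x-mid≤∑mid = ≤-trans (∑-mono-≤ (λ r → x≤∑ F (i + suc r)) (suc k′))
                          (≤-reflexive (∑-comm (λ r u → 𝟙 (F (arc u (i + suc r)))) (suc k′) N))

  x-window : ℕ → ℕ
  x-window i = x σ F i + (∑[ r < suc k′ ] x σ F (i + suc r) + x σ F (i + C))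

  2≤N : 2 ≤ N
  2≤N = ≤-trans (s≤s (s≤s z≤n)) k≤N

  x-window-interior : ∀ i → 0 < i → i + C < N → x-window i ≤ N * C
  x-window-interior i 0<i i+C<N =
    ≤-trans (+-mono-≤ (x≤∑ F i) (+-mono-≤ ∑x-mid≤∑mid (x≤∑ F (i + C))))
      (double-count {d = 0} {β = 𝟙 ∘ bot} {mid} {𝟙 ∘ top} 2≤N
                    (𝟙-arc-periodic i) mid-periodic (𝟙-arc-periodic (i + C))
        (λ u → window u (top u) (top (suc u)) (bot (suc u)) (bot (suc (suc u))) (no-Y i+C<N) (no-Y′ 0<i (<⇒≤ i+C<N))))
    where open Levels i

  -- On an extreme level the unique interval (∅ here, [n] in x-window-top) fills one end slot of every
  -- window, the other slot being false; it plays the role of the constant d of double-count.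
  x-window-bottom : x-window 0 ≤ N * C
  x-window-bottom =
    ≤-trans (+-mono-≤ (x≤𝟙 F {0} {⊥} (λ _ → refl))
                      (≤-trans (+-mono-≤ ∑x-mid≤∑mid (x≤∑ F C)) (m≤n+m _ (∑[ u < N ] 0))))
      (double-count {d = 𝟙 (F ⊥)} {β = λ _ → 0} {mid} {𝟙 ∘ top} 2≤N
                    (λ _ → refl) mid-periodic (𝟙-arc-periodic C)
        (λ u → window u (top u) (top (suc u)) (F ⊥) false
                 (λ full top₁ top₂ → no-Y k≤N full top₁ top₂ ∘ Sum.map₂ λ ()) (λ _ _ ())))
    where open Levels 0

  x-window-top : ∀ i → 0 < i → i + C ≡ N → x-window i ≤ N * C
  x-window-top i 0<i i+C≡N = begin
    x-window i
      ≤⟨ +-mono-≤ (x≤∑ F i) (+-mono-≤ ∑x-mid≤∑mid x-top≤) ⟩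
    ∑[ u < N ] 𝟙 (bot u) + (∑[ u < N ] mid u + 𝟙 (F ⊤))
      ≡⟨ shuffle (∑[ u < N ] 𝟙 (bot u)) (∑[ u < N ] mid u) (𝟙 (F ⊤)) ⟩
    𝟙 (F ⊤) + (∑[ u < N ] 𝟙 (bot u) + (∑[ u < N ] mid u + 0))
      ≡⟨ cong (λ z → 𝟙 (F ⊤) + (∑[ u < N ] 𝟙 (bot u) + (∑[ u < N ] mid u + z))) (sym ∑0) ⟩
    𝟙 (F ⊤) + (∑[ u < N ] 𝟙 (bot u) + (∑[ u < N ] mid u + ∑[ u < N ] 0))
      ≤⟨ double-count {d = 𝟙 (F ⊤)} {β = 𝟙 ∘ bot} {mid} {λ _ → 0} 2≤N
                      (𝟙-arc-periodic i) mid-periodic (λ _ → refl)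
           (λ u → window u false (F ⊤) (bot (suc u)) (bot (suc (suc u))) (λ _ ())
                    (λ full bot₁ bot₂ → no-Y′ 0<i (≤-reflexive i+C≡N) full bot₁ bot₂
                                        ∘ Sum.map (λ ()) (subst T (cong F (sym arc-top≡⊤))))) ⟩
    N * C ∎
    where
    open Levels i
    open ≤-Reasoning
    arc-top≡⊤ : ∀ {v} → arc v (i + C) ≡ ⊤
    arc-top≡⊤ {v} = trans (cong (arc v) i+C≡N) (arc-full v)
    x-top≤ : x σ F (i + C) ≤ 𝟙 (F ⊤)
    x-top≤ = x≤𝟙 F {i + C} (λ t → trans (interval≡arc t (i + C)) arc-top≡⊤)
    ∑0 : ∑[ u < N ] 0 ≡ 0
    ∑0 = trans (∑-const 0 N) (*-zeroʳ N)
    shuffle : ∀ b m d → b + (m + d) ≡ d + (b + (m + 0))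
    shuffle = solve-∀

  x-window≤ : ∀ i → i + C ≤ N → x-window i ≤ N * C
  x-window≤ zero    _     = x-window-bottom
  x-window≤ (suc i) i+C≤N with m≤n⇒m<n∨m≡n i+C≤N
  ... | inj₁ i+C<N = x-window-interior (suc i) (s≤s z≤n) i+C<N
  ... | inj₂ i+C≡N = x-window-top (suc i) (s≤s z≤n) i+C≡N

lemma1 : (n k : ℕ) → 3 ≤ k → k ≤ n → (F : Family n) →
    ¬ ContainsY k F → ¬ ContainsY′ k F → (σ : Permutation′ n) →
    (i : ℕ) → i ≤ n ∸ k + 1 →
    sum (map (λ r → x σ F (i + r)) (upTo k)) ≤ (k ∸ 1) * n
lemma1 zero _ (s≤s _) () _ _ _ _ _ _
lemma1 (suc m) k@(suc (suc (suc k′))) (s≤s (s≤s (s≤s _))) k≤n F noY noY′ σ i i≤n∸k+1 = begin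
  sum (map (λ r → x σ F (i + r)) (upTo k))
    ≡⟨ cong sum (map-upTo (λ r → x σ F (i + r)) k) ⟩
  ∑[ r < k ] x σ F (i + r)
    ≡⟨ cong₂ _+_ (cong (x σ F) (+-identityʳ i)) (∑-suc (λ r → x σ F (i + suc r)) (suc k′)) ⟩
  x-window i
    ≤⟨ x-window≤ i i+C≤N ⟩
  N * C
    ≡⟨ *-comm N C ⟩
  C * N ∎
  where
  open Windows σ F k′ k≤n noY noY′
  open Arcs σ using (N)
  open ≤-Reasoning
  i+C≤N : i + C ≤ N
  i+C≤N = ≤-trans (+-monoˡ-≤ C i≤n∸k+1) (≤-reflexive (trans (+-assoc (N ∸ k) 1 C) (m∸n+n≡m k≤n)))
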